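{- Let $G$ be a connected graph without cut-vertex that is not a clique and in which no vertex has a neighborhood that is a stable set. Let $v$ be any vertex of $G$. If $G$ has a stable cutset then so does $G-v$.
   Context: All graphs are finite and simple. A stable cutset of a graph $G$ is a set $S\subseteq V(G)$ whose vertices are pairwise non-adjacent and such that $G-S$ is disconnected (has at least two connected components); the empty set is a stable cutset of any disconnected graph. A cut-vertex is a vertex whose removal disconnects the graph. -}

module Defs where

open import Data.Nat using (ℕ)
open import Data.Fin using (Fin)
open import Data.Product using (Σ; _×_; ∃; ∃-syntax)
open import Data.Empty using (⊥)
open import Relation.Nullary using (¬_; Dec)
open import Relation.Binary.PropositionalEquality using (_≡_)

record Graph : Set₁ where
  field
    n     : ℕ
    Adj   : Fin n → Fin n → Set
    sym   : ∀ {u v} → Adj u v → Adj v u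
    irrefl : ∀ {u} → ¬ Adj u u
    dec   : ∀ u v → Dec (Adj u v)

module _ (G : Graph) where
  open Graph G

  V : Set
  V = Fin n

  VSet : Set₁
  VSet = V → Set

  Full : VSet
  Full _ = Data.Unit.⊤ where import Data.Unit

  _∖_ : VSet → VSet → VSet
  (X ∖ S) u = X u × ¬ S u

  Minus : V → VSet
  Minus v u = ¬ (u ≡ v)

  _⊆_ : VSet → VSet → Set
  S ⊆ X = ∀ u → S u → X u

  data Walk (X : VSet) : V → V → Set where
    here : ∀ {u} → X u → Walk X u u
    step : ∀ {u w v} → X u → Adj u w → Walk X w v → Walk X u v

  Connected : VSet → Set
  Connected X = ∀ u v → X u → X v → Walk X u v

  Disconnected : VSet → Set
  Disconnected X = ∃[ u ] ∃[ v ] (X u × X v × ¬ Walk X u v)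

  Stable : VSet → Set
  Stable S = ∀ u v → S u → S v → ¬ Adj u v

  StableCutset : VSet → VSet → Set
  StableCutset X S = S ⊆ X × Stable S × Disconnected (X ∖ S)

  HasStableCutset : VSet → Set₁
  HasStableCutset X = Σ VSet (StableCutset X)

  CutVertex : V → Set
  CutVertex w = Disconnected (Minus w)

  Clique : Set
  Clique = ∀ u v → ¬ (u ≡ v) → Adj u v

  Nbhd : V → VSet
  Nbhd v u = Adj v u

{-# OPTIONS --safe #-}
-- Let S be a stable cutset of G with a and b in different components of G − S.
-- Since N(v) is not stable, it is not contained in S, so v has a neighbour c ∉ S.
-- After replacing a or b by c when it equals v, S ∖ {v} separates the two vertices
-- in G − v, because a walk in G − v avoiding S ∖ {v} avoids S.
-- Membership in S need not be decidable, so the argument runs under a double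
-- negation. That is harmless: for decidable X, a stable cutset of G[X] can be
-- witnessed by two subsets of the finite vertex set (the cutset and a union of
-- components), and the existence of such a witness is decidable.
module Submission where

open import Defs
open import Level using (Level)
open import Data.Nat using (zero; suc)
open import Data.Fin using (Fin; _≟_)
open import Data.Fin.Properties using (all?; any?)
open import Data.Fin.Subset using (Subset; inside; outside; _∈_; _∉_)
open import Data.Fin.Subset.Properties using (_∈?_; anySubset?; drop-there)
open import Data.Vec.Base using ([]; _∷_; here; there)
open import Data.Product using (Σ-syntax; ∃; _×_; _,_; proj₁; proj₂)
open import Data.Unit using (tt)
open import Data.Empty using (⊥-elim)
open import Function using (_∘_)
open import Function.Bundles using (_⇔_; mk⇔; Equivalence)
open import Relation.Unary using (Pred; Decidable; _≐_)
open import Relation.Nullary using (¬_; Dec; yes; no)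
open import Relation.Nullary.Decidable using (_×-dec_; _→-dec_; ¬?; ¬¬-excluded-middle; decidable-stable)
import Relation.Nullary.Decidable as Dec
open import Relation.Nullary.Negation using (¬¬-map)
open import Relation.Binary.PropositionalEquality using (_≢_; refl; subst)

open Equivalence using (to; from)

private
  variable
    ℓ : Level

¬¬-subset : ∀ {n} (P : Pred (Fin n) ℓ) → ¬ ¬ (Σ[ T ∈ Subset n ] (∀ x → x ∈ T ⇔ P x))
¬¬-subset {n = zero}  P k = k ([] , λ ())
¬¬-subset {n = suc n} P k =
  ¬¬-excluded-middle λ P0? → ¬¬-subset (P ∘ Fin.suc) λ (T , T⇔P) → k (extend P0? T T⇔P)
  where
  there⇔ : ∀ {s} {T : Subset n} {x} {Q : Set ℓ} → x ∈ T ⇔ Q → Fin.suc x ∈ s ∷ T ⇔ Q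
  there⇔ e = mk⇔ (to e ∘ drop-there) (there ∘ from e)

  extend : Dec (P Fin.zero) → (T : Subset n) → (∀ x → x ∈ T ⇔ P (Fin.suc x))
         → Σ[ T′ ∈ Subset (suc n) ] (∀ x → x ∈ T′ ⇔ P x)
  extend (yes P0) T T⇔P = inside ∷ T , λ where
    Fin.zero    → mk⇔ (λ _ → P0) (λ _ → here)
    (Fin.suc x) → there⇔ (T⇔P x)
  extend (no ¬P0) T T⇔P = outside ∷ T , λ where
    Fin.zero    → mk⇔ (λ ()) (⊥-elim ∘ ¬P0)
    (Fin.suc x) → there⇔ (T⇔P x)

¬¬-decidable : ∀ {n} (P : Pred (Fin n) ℓ) → ¬ ¬ Decidable P
¬¬-decidable P = ¬¬-map (λ (T , T⇔P) x → Dec.map (T⇔P x) (x ∈? T)) (¬¬-subset P)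

module _ (G : Graph) where
  open Graph G renaming (sym to Adj-sym)

  private
    variable
      X Y Y′ A : VSet G
      x y z : V G

  walk-head : Walk G X x y → X x
  walk-head (here Xx)     = Xx
  walk-head (step Xx _ _) = Xx

  walk-last : Walk G X x y → X y
  walk-last (here Xx)       = Xx
  walk-last (step _ _ rest) = walk-last rest

  walk-mono : (∀ {u} → X u → Y u) → Walk G X x y → Walk G Y x y
  walk-mono X⊆Y (here Xx)         = here (X⊆Y Xx)
  walk-mono X⊆Y (step Xx xw rest) = step (X⊆Y Xx) xw (walk-mono X⊆Y rest)

  _++ʷ_ : Walk G X x y → Walk G X y z → Walk G X x z
  here _          ++ʷ walk = walk
  step Xx xw rest ++ʷ walk = step Xx xw (rest ++ʷ walk)

  walk-snoc : Walk G X x y → Adj y z → X z → Walk G X x z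
  walk-snoc walk yz Xz = walk ++ʷ step (walk-last walk) yz (here Xz)

  walk-reverse : Walk G X x y → Walk G X y x
  walk-reverse (here Xx)         = here Xx
  walk-reverse (step Xx xw rest) = walk-snoc (walk-reverse rest) (Adj-sym xw) Xx

  disconnected-resp-≐ : Y ≐ Y′ → Disconnected G Y → Disconnected G Y′
  disconnected-resp-≐ (Y⊆Y′ , Y′⊆Y) (x , y , Yx , Yy , ¬walk) =
    x , y , Y⊆Y′ Yx , Y⊆Y′ Yy , ¬walk ∘ walk-mono Y′⊆Y

  Closed : VSet G → VSet G → Set
  Closed Y A = ∀ x y → Y x → Y y → A x → Adj x y → A y

  closed-walk : Closed Y A → A x → Walk G Y x y → A y
  closed-walk closed Ax (here _)          = Ax
  closed-walk closed Ax (step Yx xw rest) =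
    closed-walk closed (closed _ _ Yx (walk-head rest) Ax xw) rest

  Separated : VSet G → Set
  Separated Y = Σ[ A ∈ Subset n ] Σ[ p ∈ V G ] Σ[ q ∈ V G ]
    (Y p × Y q × p ∈ A × q ∉ A × Closed Y (_∈ A))

  separated⇒disconnected : Separated Y → Disconnected G Y
  separated⇒disconnected (A , p , q , Yp , Yq , p∈A , q∉A , closed) =
    p , q , Yp , Yq , q∉A ∘ closed-walk closed p∈A

  disconnected⇒¬¬separated : Disconnected G Y → ¬ ¬ Separated Y
  disconnected⇒¬¬separated (p , q , Yp , Yq , ¬walk) k =
    ¬¬-subset (Walk G _ p) λ (A , A⇔reach) → k (A , p , q , Yp , Yq ,
      from (A⇔reach p) (here Yp) ,
      ¬walk ∘ to (A⇔reach q) ,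
      λ x y _ Yy x∈A xy → from (A⇔reach y) (walk-snoc (to (A⇔reach x) x∈A) xy Yy))

  separated? : Decidable Y → Dec (Separated Y)
  separated? Y? = anySubset? λ A → any? λ p → any? λ q →
    Y? p ×-dec Y? q ×-dec p ∈? A ×-dec ¬? (q ∈? A) ×-dec
    all? λ x → all? λ y → Y? x →-dec Y? y →-dec x ∈? A →-dec dec x y →-dec y ∈? A

  FiniteStableCutset : VSet G → Set
  FiniteStableCutset X = Σ[ T ∈ Subset n ]
    (_⊆_ G (_∈ T) X × Stable G (_∈ T) × Separated (_∖_ G X (_∈ T)))

  finiteStableCutset? : Decidable X → Dec (FiniteStableCutset X)
  finiteStableCutset? X? = anySubset? λ T →
    (all? λ x → x ∈? T →-dec X? x) ×-dec
    (all? λ x → all? λ y → x ∈? T →-dec y ∈? T →-dec ¬? (dec x y)) ×-dec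
    separated? (λ x → X? x ×-dec ¬? (x ∈? T))

  finite⇒hasStableCutset : FiniteStableCutset X → HasStableCutset G X
  finite⇒hasStableCutset (T , T⊆X , T-stable , separated) =
    (_∈ T) , T⊆X , T-stable , separated⇒disconnected separated

  hasStableCutset⇒¬¬finite : HasStableCutset G X → ¬ ¬ FiniteStableCutset X
  hasStableCutset⇒¬¬finite (S , S⊆X , S-stable , disconnected) k =
    ¬¬-subset S λ (T , T⇔S) →
      disconnected⇒¬¬separated (disconnected-resp-≐ (same T⇔S) disconnected) λ separated →
        k (T , (λ x → S⊆X x ∘ to (T⇔S x)) ,
               (λ x y x∈T y∈T → S-stable x y (to (T⇔S x) x∈T) (to (T⇔S y) y∈T)) ,
               separated)
    where
    same : ∀ {T} → (∀ x → x ∈ T ⇔ S x) → _∖_ G X S ≐ _∖_ G X (_∈ T)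
    same T⇔S = (λ (Xx , ¬Sx) → Xx , ¬Sx ∘ to (T⇔S _)) , (λ (Xx , x∉T) → Xx , x∉T ∘ from (T⇔S _))

  hasStableCutset-stable : Decidable X → ¬ ¬ HasStableCutset G X → HasStableCutset G X
  hasStableCutset-stable X? ¬¬cutset with finiteStableCutset? X?
  ... | yes finite = finite⇒hasStableCutset finite
  ... | no ¬finite = ⊥-elim (¬¬cutset λ cutset → hasStableCutset⇒¬¬finite cutset ¬finite)

  ¬stable⇒⊈stable : {Y S : VSet G} → Decidable Y → Decidable S
                  → ¬ Stable G Y → Stable G S → ∃ λ c → Y c × ¬ S c
  ¬stable⇒⊈stable {Y} {S} Y? S? Y-unstable S-stable with any? (λ c → Y? c ×-dec ¬? (S? c))
  ... | yes found = found
  ... | no ¬found = ⊥-elim (Y-unstable λ x y Yx Yy → S-stable x y (Y⊆S Yx) (Y⊆S Yy))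
    where
    Y⊆S : ∀ {x} → Y x → S x
    Y⊆S {x} Yx = decidable-stable (S? x) λ ¬Sx → ¬found (x , Yx , ¬Sx)

  stableCutset-Minus : ∀ {S} v c → Adj v c → ¬ S c → StableCutset G (Full G) S
                     → StableCutset G (Minus G v) (λ u → S u × u ≢ v)
  stableCutset-Minus {S} v c vc c∉S (_ , S-stable , a , b , (_ , a∉S) , (_ , b∉S) , ¬walk) =
    let p , p≢v , p∉S , ap = avoid-v a a∉S
        q , q≢v , q∉S , bq = avoid-v b b∉S
    in (λ _ → proj₂) , (λ x y S′x S′y → S-stable x y (proj₁ S′x) (proj₁ S′y)) ,
       p , q , (p≢v , p∉S ∘ proj₁) , (q≢v , q∉S ∘ proj₁) ,
       λ pq → ¬walk (ap ++ʷ (walk-mono lift pq ++ʷ walk-reverse bq))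
    where
    lift : ∀ {u} → _∖_ G (Minus G v) (λ u → S u × u ≢ v) u → _∖_ G (Full G) S u
    lift (u≢v , u∉S′) = tt , λ Su → u∉S′ (Su , u≢v)

    avoid-v : ∀ a → ¬ S a → ∃ λ p → p ≢ v × ¬ S p × Walk G (_∖_ G (Full G) S) a p
    avoid-v a a∉S with a ≟ v
    ... | yes refl = c , (λ c≡v → irrefl (subst (Adj v) c≡v vc)) , c∉S ,
                     step (tt , a∉S) vc (here (tt , c∉S))
    ... | no a≢v   = a , a≢v , a∉S , here (tt , a∉S)

lemma2 : (G : Graph) → Connected G (Full G) → (∀ w → ¬ CutVertex G w) → ¬ Clique G
    → (∀ w → ¬ Stable G (Nbhd G w)) → (v : V G) → HasStableCutset G (Full G)
    → HasStableCutset G (Minus G v)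
lemma2 G _ _ _ unstable v (S , cutset@(_ , S-stable , _)) =
  hasStableCutset-stable G (λ u → ¬? (u ≟ v)) λ ¬cutset →
    ¬¬-decidable S λ S? →
      let c , vc , c∉S = ¬stable⇒⊈stable G (Graph.dec G v) S? (unstable v) S-stable
      in ¬cutset (_ , stableCutset-Minus G v c vc c∉S cutset)
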